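{- Let $n$ and $k$ be positive integers. Then $$(n!!)^{k!!}+n^k=(k!!)^{n!!}+k^n$$ holds if and only if $k=n$.
   Context: For a positive integer $m$, the double factorial $m!!$ is the product of all positive integers $\le m$ having the same parity as $m$, i.e. $m!!=m(m-2)(m-4)\cdots$, ending in $1$ if $m$ is odd and in $2$ if $m$ is even. -}

module Defs where

open import Data.Nat using (ℕ; zero; suc; _*_)

-- Double factorial: m!! = m (m-2) (m-4) ..., ending in 1 or 2; 0!! = 1 by convention
-- (only used for positive m in the statement).
_!! : ℕ → ℕ
zero !! = 1
suc zero !! = 1
suc (suc m) !! = suc (suc m) * (m !!)

{-# OPTIONS --safe #-}
-- Suppose n < k.  For 3 ≤ x < y one has y ^ x < x ^ y: for y = x + 1 by induction on x,
-- using (x + 2) x < (x + 1)², and for larger y by raising to powers and chaining.  When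
-- n ≥ 3 this applies to both pairs n!! < k!! and n < k, so the right-hand side is strictly
-- smaller.  For n = 2 the comparison is m ^ 2 against 2 ^ m, and for n = 1 the left-hand
-- side is just 2.
module Submission where

open import Defs
open import Data.Nat using (ℕ; _+_; _^_; _≥_)
open import Relation.Binary.PropositionalEquality using (_≡_)
open import Function.Bundles using (_⇔_)

open import Data.Nat using (zero; suc; _*_; _≤_; _<_; _≤′_; _<′_; ≤′-reflexive; ≤′-refl; ≤′-step; s≤s; z≤n; _<?_)
open import Data.Nat.Properties
open import Data.Nat.Tactic.RingSolver using (solve-∀)
open import Data.Sum using (inj₁; inj₂)
open import Data.Unit using (tt)
open import Function.Bundles using (mk⇔)
open import Relation.Binary.Definitions using (tri<; tri≈; tri>)
open import Relation.Binary.PropositionalEquality using (_≢_; refl; sym; cong; cong₂; module ≡-Reasoning)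
open import Relation.Nullary using (yes; no; contradiction)

^-distribʳ-* : ∀ m n o → (m * n) ^ o ≡ m ^ o * n ^ o
^-distribʳ-* m n zero    = refl
^-distribʳ-* m n (suc o) = begin
  m * n * (m * n) ^ o     ≡⟨ cong (m * n *_) (^-distribʳ-* m n o) ⟩
  m * n * (m ^ o * n ^ o) ≡⟨ [m*n]*[o*p]≡[m*o]*[n*p] m n (m ^ o) (n ^ o) ⟩
  m ^ suc o * n ^ suc o   ∎
  where open ≡-Reasoning

[m^n]^o≡[m^o]^n : ∀ m n o → (m ^ n) ^ o ≡ (m ^ o) ^ n
[m^n]^o≡[m^o]^n m n o = begin
  (m ^ n) ^ o  ≡⟨ ^-*-assoc m n o ⟩
  m ^ (n * o)  ≡⟨ cong (m ^_) (*-comm n o) ⟩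
  m ^ (o * n)  ≡⟨ ^-*-assoc m o n ⟨
  (m ^ o) ^ n  ∎
  where open ≡-Reasoning

^-cancelʳ-< : ∀ {m n} o → m ^ o < n ^ o → m < n
^-cancelʳ-< {m} {n} o mᵒ<nᵒ with m <? n
... | yes m<n = m<n
... | no  m≮n = contradiction (^-monoˡ-≤ o (≮⇒≥ m≮n)) (<⇒≱ mᵒ<nᵒ)

[1+n]^n<n^[1+n] : ∀ {n} → 3 ≤ n → suc n ^ n < n ^ suc n
[1+n]^n<n^[1+n] 3≤n = go (≤⇒≤′ 3≤n)
  where
  [2+n]*n<[1+n]*[1+n] : ∀ n → suc (suc n) * n < suc n * suc n
  [2+n]*n<[1+n]*[1+n] n = ≤-reflexive (square n)
    where
    square : ∀ n → suc (suc (suc n) * n) ≡ suc n * suc n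
    square = solve-∀

  regroup : ∀ m x → m * x * (m * x) ≡ m * (m * x) * x
  regroup = solve-∀

  go : ∀ {n} → 3 ≤′ n → suc n ^ n < n ^ suc n
  go ≤′-refl = ≤ᵇ⇒≤ 65 81 tt
  go (≤′-step {n} 3≤′n) = *-cancelʳ-< (n ^ suc n) _ _ (begin-strict
    suc (suc n) ^ suc n * n ^ suc n   ≡⟨ ^-distribʳ-* (suc (suc n)) n (suc n) ⟨
    (suc (suc n) * n) ^ suc n         <⟨ ^-monoˡ-< (suc n) ([2+n]*n<[1+n]*[1+n] n) ⟩
    (suc n * suc n) ^ suc n           ≡⟨ ^-distribʳ-* (suc n) (suc n) (suc n) ⟩
    suc n ^ suc n * suc n ^ suc n     ≡⟨ regroup (suc n) (suc n ^ n) ⟩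
    suc n ^ suc (suc n) * suc n ^ n   <⟨ *-monoʳ-< (suc n ^ suc (suc n)) {{m^n≢0 (suc n) (suc (suc n))}} (go 3≤′n) ⟩
    suc n ^ suc (suc n) * n ^ suc n   ∎)
    where open ≤-Reasoning

n^m<m^n : ∀ {m n} → 3 ≤ m → m < n → n ^ m < m ^ n
n^m<m^n {m} 3≤m@(s≤s _) m<n = go (<⇒<′ m<n)
  where
  go : ∀ {n} → m <′ n → n ^ m < m ^ n
  go ≤′-refl = [1+n]^n<n^[1+n] 3≤m
  go (≤′-step {n} m<′n) = ^-cancelʳ-< n (begin-strict
    (suc n ^ m) ^ n   ≡⟨ [m^n]^o≡[m^o]^n (suc n) m n ⟩
    (suc n ^ n) ^ m   <⟨ ^-monoˡ-< m ([1+n]^n<n^[1+n] (≤-trans 3≤m (<⇒≤ (≤′⇒≤ m<′n)))) ⟩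
    (n ^ suc n) ^ m   ≡⟨ [m^n]^o≡[m^o]^n n (suc n) m ⟩
    (n ^ m) ^ suc n   <⟨ ^-monoˡ-< (suc n) (go m<′n) ⟩
    (m ^ n) ^ suc n   ≡⟨ [m^n]^o≡[m^o]^n m n (suc n) ⟩
    (m ^ suc n) ^ n   ∎)
    where open ≤-Reasoning

[1+n]^2≤2*n^2 : ∀ {n} → 3 ≤ n → suc n ^ 2 ≤ 2 * n ^ 2
[1+n]^2≤2*n^2 {suc (suc (suc p))} (s≤s (s≤s (s≤s _))) =
  ≤-trans (m≤m+n (suc n ^ 2) (p * p + 4 * p + 2)) (≤-reflexive (expand p))
  where
  n = 3 + p
  expand : ∀ p → (4 + p) * ((4 + p) * 1) + (p * p + 4 * p + 2) ≡ 2 * ((3 + p) * ((3 + p) * 1))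
  expand = solve-∀

n^2<2^n : ∀ {n} → 5 ≤ n → n ^ 2 < 2 ^ n
n^2<2^n 5≤n = go (≤⇒≤′ 5≤n)
  where
  go : ∀ {n} → 5 ≤′ n → n ^ 2 < 2 ^ n
  go ≤′-refl = ≤ᵇ⇒≤ 26 32 tt
  go (≤′-step {n} 5≤′n) = begin-strict
    suc n ^ 2  ≤⟨ [1+n]^2≤2*n^2 (≤-trans (≤ᵇ⇒≤ 3 5 tt) (≤′⇒≤ 5≤′n)) ⟩
    2 * n ^ 2  <⟨ *-monoʳ-< 2 (go 5≤′n) ⟩
    2 * 2 ^ n  ∎
    where open ≤-Reasoning

n^2≤2^n : ∀ {n} → 4 ≤ n → n ^ 2 ≤ 2 ^ n
n^2≤2^n 4≤n with m≤n⇒m<n∨m≡n 4≤n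
... | inj₁ 4<n  = <⇒≤ (n^2<2^n 4<n)
... | inj₂ refl = ≤-refl

-- 0 !! ≡ 1 !!, so the double factorial is strictly increasing only from 1 on.
!!-<-suc : ∀ n → suc n !! < suc (suc n) !!
!!-<-suc zero          = ≤-refl
!!-<-suc (suc zero)    = ≤-refl
!!-<-suc (suc (suc n)) = *-mono-< (n<1+n (3 + n)) (!!-<-suc n)

!!-<-mono : ∀ {m n} → 1 ≤ m → m < n → m !! < n !!
!!-<-mono {suc m} _ m<n = go (<⇒<′ m<n)
  where
  go : ∀ {n} → suc m <′ n → suc m !! < n !!
  go ≤′-refl                   = !!-<-suc m
  go (≤′-step {zero} (≤′-reflexive ()))
  go (≤′-step {suc n} sm<′sn) = <-trans (go sm<′sn) (!!-<-suc n)

!!-mono-≤ : ∀ {m n} → 1 ≤ m → m ≤ n → m !! ≤ n !!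
!!-mono-≤ 1≤m m≤n with m≤n⇒m<n∨m≡n m≤n
... | inj₁ m<n  = <⇒≤ (!!-<-mono 1≤m m<n)
... | inj₂ refl = ≤-refl

mixedSum : ℕ → ℕ → ℕ
mixedSum n k = (n !!) ^ (k !!) + n ^ k

mixedSum-1< : ∀ {k} → 1 < k → mixedSum 1 k < mixedSum k 1
mixedSum-1< {k} 1<k = begin-strict
  1 ^ (k !!) + 1 ^ k   ≡⟨ cong₂ _+_ (^-zeroˡ (k !!)) (^-zeroˡ k) ⟩
  1 + 1                <⟨ +-mono-< (!!-<-mono ≤-refl 1<k) 1<k ⟩
  k !! + k             ≡⟨ cong₂ _+_ (^-identityʳ (k !!)) (^-identityʳ k) ⟨
  (k !!) ^ 1 + k ^ 1   ∎
  where open ≤-Reasoning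

mixedSum-<2 : ∀ {k} → 3 < k → mixedSum k 2 < mixedSum 2 k
mixedSum-<2 4≤k = +-mono-<-≤ (n^2<2^n (≤-trans (≤ᵇ⇒≤ 5 8 tt) (!!-mono-≤ (s≤s z≤n) 4≤k)))
                             (n^2≤2^n 4≤k)

mixedSum-< : ∀ {n k} → 3 ≤ n → n < k → mixedSum k n < mixedSum n k
mixedSum-< 3≤n n<k = +-mono-< (n^m<m^n (!!-mono-≤ (s≤s z≤n) 3≤n) (!!-<-mono (≤-trans (s≤s z≤n) 3≤n) n<k))
                              (n^m<m^n 3≤n n<k)

mixedSum-≢ : ∀ {n k} → 1 ≤ n → n < k → mixedSum n k ≢ mixedSum k n
mixedSum-≢ {1} _ 1<k = <⇒≢ (mixedSum-1< 1<k)
mixedSum-≢ {2} _ 2<k with m≤n⇒m<n∨m≡n 2<k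
... | inj₁ 3<k  = >⇒≢ (mixedSum-<2 3<k)
... | inj₂ refl = λ ()
mixedSum-≢ {suc (suc (suc n))} _ n<k = >⇒≢ (mixedSum-< (s≤s (s≤s (s≤s z≤n))) n<k)

theorem1p5 : ∀ (n k : ℕ) → n ≥ 1 → k ≥ 1 →
    (((n !!) ^ (k !!)) + (n ^ k) ≡ ((k !!) ^ (n !!)) + (k ^ n)) ⇔ (k ≡ n)
theorem1p5 n k 1≤n 1≤k = mk⇔ solution⇒≡ λ { refl → refl }
  where
  solution⇒≡ : mixedSum n k ≡ mixedSum k n → k ≡ n
  solution⇒≡ eq with <-cmp n k
  ... | tri< n<k _ _ = contradiction eq (mixedSum-≢ 1≤n n<k)
  ... | tri≈ _ n≡k _ = sym n≡k
  ... | tri> _ _ k<n = contradiction (sym eq) (mixedSum-≢ 1≤k k<n)
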